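{- Let $d\geqslant3$ and let $\mathcal W$ be a subset of $\mathrm{Bin}(d,\mathbb Z)$ such that every $F(X,Y)=\sum_{i=0}^da_iX^{d-i}Y^i$ in $\mathcal W$ satisfies: (1) $a_0>0$, $a_d\neq0$, and $a_0,a_d$ are $d$-free; (2) if there is an odd index $k$ with $a_k\neq0$, then for the smallest such $k$, $a_k>0$. Then: (a) $\mathcal W$ is $\mathbb Q$-dilation-free. (b) If $F\in\mathcal W$ and $\gamma=\begin{pmatrix}u&0\\0&v\end{pmatrix}\in\mathrm{GL}(2,\mathbb Q)$ satisfies $F\circ\gamma=F$, then $\gamma=\pm\mathrm{Id}$ if $F$ is not a binary form with squared arguments, and $\gamma\in\{\pm\mathrm{Id},\pm\mathrm{diag}(1,-1)\}$ if $F$ is a binary form with squared arguments.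
   Context: $\mathrm{Bin}(d,\mathbb Z)$: binary forms of degree $d$ with integer coefficients and nonzero discriminant. A nonzero integer $a$ is $d$-free if no prime $p$ satisfies $p^d\mid a$. $(F\circ\gamma)(X,Y)=F(uX,vY)$ for $\gamma=\mathrm{diag}(u,v)$. A set $\mathcal W$ is $\mathbb Q$-dilation-free if for all $F,G\in\mathcal W$ and $u,v\in\mathbb Q^\times$, $F(uX,vY)=G(X,Y)$ implies $F=G$. $F$ is a binary form with squared arguments if $F(X,Y)=H(X^2,Y^2)$ for some binary form $H$. -}

module Defs where

open import Data.Nat as ℕ using (ℕ; zero; suc; _∸_; _<?_; _≤?_; NonZero)
open import Data.Nat.Properties using (m^n≢0)
open import Data.Nat.Primality using (Prime)
open import Data.Nat.Divisibility using (_∣_)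
open import Data.Integer as ℤ using (ℤ; +_; -1ℤ; ∣_∣; _/ℕ_)
open import Data.Rational as ℚ using (ℚ; 1ℚ; 0ℚ)
open import Data.Fin as Fin using (Fin; toℕ; fromℕ; punchIn)
open import Data.Vec using (Vec; []; _∷_; lookup)
open import Data.Bool using (if_then_else_)
open import Data.Product using (Σ; ∃; _×_)
open import Relation.Nullary using (¬_; does)
open import Relation.Binary.PropositionalEquality using (_≡_; _≢_)

-- A binary form of degree d:  F(X,Y) = Σ_{i=0}^d a_i X^(d-i) Y^i,
-- represented by its coefficient vector (a_0, …, a_d).
Form : ℕ → Set
Form d = Vec ℤ (suc d)

at : ∀ {n} → Vec ℤ n → ℕ → ℤ
at []       _       = + 0
at (x ∷ xs) zero    = x
at (x ∷ xs) (suc i) = at xs i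

sumFin : ∀ n → (Fin n → ℤ) → ℤ
sumFin zero    f = + 0
sumFin (suc n) f = f Fin.zero ℤ.+ sumFin n (λ i → f (Fin.suc i))

det : ∀ n → (Fin n → Fin n → ℤ) → ℤ
det zero    M = + 1
det (suc n) M = sumFin (suc n) λ j →
  (-1ℤ ℤ.^ toℕ j) ℤ.* (M Fin.zero j ℤ.* det n (λ r c → M (Fin.suc r) (punchIn j c)))

-- Sylvester matrix of binary forms P (degree m) and Q (degree n), given by
-- coefficient functions p_0..p_m, q_0..q_n (p_0 the coefficient of X^m)
sylvester : ∀ m n → (ℕ → ℤ) → (ℕ → ℤ) → Fin (m ℕ.+ n) → Fin (m ℕ.+ n) → ℤ
sylvester m n P Q r c = entry (toℕ r) (toℕ c)
  where
  entry : ℕ → ℕ → ℤ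
  entry r c =
    if does (r <? n)
    then (if does (r ≤? c) then P (c ∸ r) else + 0)
    else (if does ((r ∸ n) ≤? c) then Q (c ∸ (r ∸ n)) else + 0)

resultant : ∀ m n → (ℕ → ℤ) → (ℕ → ℤ) → ℤ
resultant m n P Q = det (m ℕ.+ n) (sylvester m n P Q)

∂X : ∀ {d} → Form d → ℕ → ℤ
∂X {d} F i = + (d ∸ i) ℤ.* at F i

∂Y : ∀ {d} → Form d → ℕ → ℤ
∂Y F i = + (suc i) ℤ.* at F (suc i)

nz : ∀ d → NonZero (d ℕ.^ (d ∸ 2))
nz zero          = _
nz d@(suc k)     = m^n≢0 d (d ∸ 2)

-- discriminant, via  d^(d-2) Disc(F) = (-1)^(d(d-1)/2) Res(∂F/∂X, ∂F/∂Y)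
disc : ∀ {d} → Form d → ℤ
disc {d} F =
  ((-1ℤ ℤ.^ ((d ℕ.* (d ∸ 1)) ℕ./ 2)) ℤ.* resultant (d ∸ 1) (d ∸ 1) (∂X F) (∂Y F))
    /ℕ (d ℕ.^ (d ∸ 2)) where instance _ = nz d

InBin : ∀ {d} → Form d → Set
InBin F = disc F ≢ + 0

DFree : ℕ → ℤ → Set
DFree d a = a ≢ + 0 × (∀ p → Prime p → ¬ ((p ℕ.^ d) ∣ ∣ a ∣))

Odd : ℕ → Set
Odd k = k ℕ.% 2 ≡ 1

_^q_ : ℚ → ℕ → ℚ
q ^q zero  = 1ℚ
q ^q suc n = q ℚ.* (q ^q n)

toℚ : ℤ → ℚ
toℚ z = z ℚ./ 1

-- coefficients of F ∘ diag(u,v), i.e. of F(uX, vY):  a_i u^(d-i) v^i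
dilate : ∀ {d} → Form d → ℚ → ℚ → Fin (suc d) → ℚ
dilate {d} F u v i = toℚ (lookup F i) ℚ.* ((u ^q (d ∸ toℕ i)) ℚ.* (v ^q toℕ i))

DilatesTo : ∀ {d} → Form d → ℚ → ℚ → Form d → Set
DilatesTo F u v G = ∀ i → dilate F u v i ≡ toℚ (lookup G i)

DilationFree : ∀ {d} → (Form d → Set) → Set
DilationFree {d} W =
  ∀ (F G : Form d) → W F → W G → (u v : ℚ) → u ≢ 0ℚ → v ≢ 0ℚ →
  DilatesTo F u v G → F ≡ G

-- H(X², Y²) for a binary form H of degree e: coefficient of X^(2e-i) Y^i
sqArgCoeff : ∀ {e} → Form e → ℕ → ℤ
sqArgCoeff H i = if does (i ℕ.% 2 ℕ.≟ 0) then at H (i ℕ./ 2) else + 0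

SquaredArgs : ∀ {d} → Form d → Set
SquaredArgs {d} F =
  Σ ℕ λ e → Σ (Form e) λ H → (d ≡ 2 ℕ.* e) × (∀ i → lookup F i ≡ sqArgCoeff H (toℕ i))

Conditions : ∀ d → Form d → Set
Conditions d F =
  (ℤ.+ 0 ℤ.< lookup F Fin.zero) × (lookup F (fromℕ d) ≢ + 0) ×
  DFree d (lookup F Fin.zero) × DFree d (lookup F (fromℕ d)) ×
  (∀ (k : Fin (suc d)) → Odd (toℕ k) → lookup F k ≢ + 0 →
     (∀ (j : Fin (suc d)) → Odd (toℕ j) → toℕ j ℕ.< toℕ k → lookup F j ≡ + 0) →
     ℤ.+ 0 ℤ.< lookup F k)

-- Comparing extreme coefficients of F(uX, vY) = G(X, Y) gives a₀ u^d = b₀ and a_d v^d = b_d.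
-- Writing u = n/m in lowest terms, a₀ n^d = b₀ m^d; as n^d and m^d are coprime, n^d ∣ b₀ and
-- m^d ∣ a₀, so d-freeness forces |n| = m = 1: u = ±1, and likewise v = ±1.  Since a₀, b₀ > 0,
-- u^d = 1, so the dilation multiplies a_i by (uv)^i.  If uv = -1 it negates exactly the odd
-- coefficients, and the first nonzero odd coefficient would be positive for F and negative for
-- G; hence all odd coefficients vanish and F = G.  For a self-dilation with uv = -1 this leaves
-- only even-index coefficients, and a_d ≠ 0 makes d even, so F(X, Y) = H(X², Y²).
{-# OPTIONS --safe #-}
module Submission where

open import Defs
open import Data.Nat using (ℕ; _≤_)
open import Data.Rational using (ℚ; 0ℚ; 1ℚ; -_)
open import Data.Product using (_×_; _,_)
open import Data.Sum using (_⊎_)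
open import Relation.Nullary using (¬_)
open import Relation.Binary.PropositionalEquality using (_≡_; _≢_)

open import Data.Nat as ℕ using (zero; suc; _*_; _^_; _∸_; _<_; _%_; _/_; z≤n; s≤s)
import Data.Nat.Properties as ℕ
open import Data.Nat.DivMod using (m*[n/m]≡n; /-monoˡ-≤)
open import Data.Nat.Divisibility using (_∣_; ∣-trans; ∣1⇒≡1; *-pres-∣; ∣-refl; m∣m*n; divides; m%n≡0⇒n∣m)
open import Data.Nat.Coprimality as Coprime using (Coprime; coprime-divisor)
open import Data.Nat.Primality using (Prime)
open import Data.Nat.Primality.Factorisation using (factorise)
open import Data.Nat.ListAction using (product)
open import Data.List using (_∷_)
open import Data.List.Relation.Unary.All using (_∷_)
open import Data.Integer as ℤ using (ℤ; +_; -[1+_]; ∣_∣)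
import Data.Integer.Properties as ℤ
open import Data.Rational as ℚ using (mkℚ; ↥_; ↧_; toℚᵘ)
import Data.Rational.Properties as ℚ
open import Data.Rational.Unnormalised as ℚᵘ using (mkℚᵘ; *≡*; _≃_)
import Data.Rational.Unnormalised.Properties as ℚᵘ
open import Algebra.Bundles using (CommutativeRing)
open import Algebra.Properties.CommutativeSemiring.Exp
  (CommutativeRing.commutativeSemiring ℚ.+-*-commutativeRing) as ℚ^ using ()
open import Data.Fin as Fin using (Fin; toℕ; fromℕ)
import Data.Fin.Properties as Fin
open import Data.Fin.Induction using (<-wellFounded)
open import Data.Vec using (Vec; lookup; tabulate; _∷_)
open import Data.Vec.Relation.Binary.Pointwise.Extensional using (ext; Pointwise-≡⇒≡)
open import Induction.WellFounded using (WfRec; module All)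
open import Level using (0ℓ)
open import Data.Product using (Σ; proj₂)
open import Data.Sum using (inj₁; inj₂)
open import Data.Empty using (⊥-elim)
open import Relation.Nullary using (yes; no)
open import Relation.Nullary.Decidable using (dec-true; dec-false)
open import Relation.Binary.PropositionalEquality using (refl; sym; trans; cong; cong₂; subst; module ≡-Reasoning)

private variable
  b m n o : ℕ

PowerFree : ℕ → ℕ → Set
PowerFree d n = ∀ p → Prime p → ¬ (p ^ d ∣ n)

coprime-* : Coprime m n → Coprime m o → Coprime m (n * o)
coprime-* m⊥n m⊥o (i∣m , i∣no) =
  m⊥o (i∣m , coprime-divisor (λ (j∣i , j∣n) → m⊥n (∣-trans j∣i i∣m , j∣n)) i∣no)

coprime-^ʳ : ∀ k → Coprime m n → Coprime m (n ^ k)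
coprime-^ʳ zero    _   (_ , i∣1) = ∣1⇒≡1 i∣1
coprime-^ʳ (suc k) m⊥n = coprime-* m⊥n (coprime-^ʳ k m⊥n)

coprime-^ : ∀ k → Coprime m n → Coprime (m ^ k) (n ^ k)
coprime-^ k m⊥n = Coprime.sym (coprime-^ʳ k (Coprime.sym (coprime-^ʳ k m⊥n)))

^-monoˡ-∣ : ∀ k → m ∣ n → m ^ k ∣ n ^ k
^-monoˡ-∣ zero    _   = ∣-refl
^-monoˡ-∣ (suc k) m∣n = *-pres-∣ m∣n (^-monoˡ-∣ k m∣n)

prime-divisor : ∀ n → 2 ≤ n → Σ ℕ λ p → Prime p × p ∣ n
prime-divisor 1 (s≤s ())
prime-divisor n@(suc (suc _)) _ with factorise n
... | record { factors = p ∷ ps ; isFactorisation = n≡Πps ; factorsPrime = p-prime ∷ _ } =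
  p , p-prime , subst (p ∣_) (sym n≡Πps) (m∣m*n (product ps))

powerFree-^∣⇒≡1 : ∀ d → PowerFree d n → m ^ d ∣ n → m ≢ 0 → m ≡ 1
powerFree-^∣⇒≡1 {m = zero}        d _    _      m≢0 = ⊥-elim (m≢0 refl)
powerFree-^∣⇒≡1 {m = suc zero}    d _    _      _   = refl
powerFree-^∣⇒≡1 {m = suc (suc k)} d free m^d∣n _
  with p , p-prime , p∣m ← prime-divisor (suc (suc k)) (s≤s (s≤s z≤n))
  = ⊥-elim (free p p-prime (∣-trans (^-monoˡ-∣ d p∣m) m^d∣n))

powerFree∧coprime⇒≡1 : ∀ d → PowerFree d b → Coprime m n → m ^ d ∣ b * n ^ d → m ≢ 0 → m ≡ 1
powerFree∧coprime⇒≡1 {b} {m} {n} d free m⊥n m^d∣bn^d =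
  powerFree-^∣⇒≡1 d free
    (coprime-divisor (coprime-^ d m⊥n) (subst (m ^ d ∣_) (ℕ.*-comm b (n ^ d)) m^d∣bn^d))

-- toℚ x unfolds to fromℚᵘ (mkℚᵘ x 0); the homomorphism properties of toℚ are transported from ℚᵘ.
toℚᵘ-toℚ : ∀ x → toℚᵘ (toℚ x) ≃ mkℚᵘ x 0
toℚᵘ-toℚ x = ℚ.toℚᵘ-fromℚᵘ (mkℚᵘ x 0)

toℚ-injective : ∀ {x y} → toℚ x ≡ toℚ y → x ≡ y
toℚ-injective {x} {y} eq with *≡* x*1≡y*1 ← ℚ.fromℚᵘ-injective {mkℚᵘ x 0} {mkℚᵘ y 0} eq
  = trans (sym (ℤ.*-identityʳ x)) (trans x*1≡y*1 (ℤ.*-identityʳ y))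

toℚ-* : ∀ x y → toℚ (x ℤ.* y) ≡ toℚ x ℚ.* toℚ y
toℚ-* x y = ℚ.toℚᵘ-injective (ℚᵘ.≃-trans (toℚᵘ-toℚ (x ℤ.* y))
  (ℚᵘ.≃-sym (ℚᵘ.≃-trans (ℚ.toℚᵘ-homo-* (toℚ x) (toℚ y)) (ℚᵘ.*-cong (toℚᵘ-toℚ x) (toℚᵘ-toℚ y)))))

toℚ-neg : ∀ x → toℚ (ℤ.- x) ≡ - toℚ x
toℚ-neg x = ℚ.toℚᵘ-injective (ℚᵘ.≃-trans (toℚᵘ-toℚ (ℤ.- x))
  (ℚᵘ.≃-sym (ℚᵘ.≃-trans (ℚ.toℚᵘ-homo‿- (toℚ x)) (ℚᵘ.-‿cong (toℚᵘ-toℚ x)))))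

toℚ-*-1 : ∀ a → toℚ a ℚ.* - 1ℚ ≡ toℚ (ℤ.- a)
toℚ-*-1 a = trans (sym (ℚ.neg-distribʳ-* (toℚ a) 1ℚ)) (trans (cong -_ (ℚ.*-identityʳ (toℚ a))) (sym (toℚ-neg a)))

toℚ-^ : ∀ x n → toℚ (x ℤ.^ n) ≡ toℚ x ^q n
toℚ-^ x zero    = refl
toℚ-^ x (suc n) = trans (toℚ-* x (x ℤ.^ n)) (cong (toℚ x ℚ.*_) (toℚ-^ x n))

*-toℚ-↧≡toℚ-↥ : ∀ p → p ℚ.* toℚ (↧ p) ≡ toℚ (↥ p)
*-toℚ-↧≡toℚ-↥ p@(mkℚ n k _) = ℚ.toℚᵘ-injective (begin
  toℚᵘ (p ℚ.* toℚ (+ suc k))          ≈⟨ ℚ.toℚᵘ-homo-* p (toℚ (+ suc k)) ⟩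
  mkℚᵘ n k ℚᵘ.* toℚᵘ (toℚ (+ suc k))  ≈⟨ ℚᵘ.*-congˡ {mkℚᵘ n k} (toℚᵘ-toℚ (+ suc k)) ⟩
  mkℚᵘ n k ℚᵘ.* mkℚᵘ (+ suc k) 0      ≈⟨ *≡* (trans (ℤ.*-identityʳ _) (cong (λ j → n ℤ.* + j) (sym (ℕ.*-identityʳ (suc k))))) ⟩
  mkℚᵘ n 0                            ≈⟨ toℚᵘ-toℚ n ⟨
  toℚᵘ (toℚ n)                        ∎)
  where open ℚᵘ.≃-Reasoning

abs-^ : ∀ x n → ∣ x ℤ.^ n ∣ ≡ ∣ x ∣ ^ n
abs-^ x zero    = refl
abs-^ x (suc n) = trans (ℤ.abs-* x (x ℤ.^ n)) (cong (∣ x ∣ *_) (abs-^ x n))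

^q≡^ : ∀ q n → q ^q n ≡ q ℚ^.^ n
^q≡^ q zero    = refl
^q≡^ q (suc n) = cong (q ℚ.*_) (^q≡^ q n)

^q-homo-* : ∀ q m n → q ^q (m ℕ.+ n) ≡ q ^q m ℚ.* q ^q n
^q-homo-* q m n rewrite ^q≡^ q (m ℕ.+ n) | ^q≡^ q m | ^q≡^ q n = ℚ^.^-homo-* q m n

^q-distrib-* : ∀ p q n → (p ℚ.* q) ^q n ≡ p ^q n ℚ.* q ^q n
^q-distrib-* p q n rewrite ^q≡^ (p ℚ.* q) n | ^q≡^ p n | ^q≡^ q n = ℚ^.^-distrib-* p q n

1^q≡1 : ∀ n → 1ℚ ^q n ≡ 1ℚ
1^q≡1 zero    = refl
1^q≡1 (suc n) = trans (ℚ.*-identityˡ (1ℚ ^q n)) (1^q≡1 n)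

u^[d∸i]≡u^i : ∀ {u} d {i} → u ℚ.* u ≡ 1ℚ → u ^q d ≡ 1ℚ → i ≤ d → u ^q (d ∸ i) ≡ u ^q i
u^[d∸i]≡u^i {u} d {i} u²≡1 u^d≡1 i≤d = begin
  u ^q (d ∸ i)                          ≡⟨ ℚ.*-identityʳ _ ⟨
  u ^q (d ∸ i) ℚ.* 1ℚ                   ≡⟨ cong (u ^q (d ∸ i) ℚ.*_) (trans (cong (_^q i) u²≡1) (1^q≡1 i)) ⟨
  u ^q (d ∸ i) ℚ.* (u ℚ.* u) ^q i       ≡⟨ cong (u ^q (d ∸ i) ℚ.*_) (^q-distrib-* u u i) ⟩
  u ^q (d ∸ i) ℚ.* (u ^q i ℚ.* u ^q i)  ≡⟨ ℚ.*-assoc (u ^q (d ∸ i)) (u ^q i) (u ^q i) ⟨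
  u ^q (d ∸ i) ℚ.* u ^q i ℚ.* u ^q i    ≡⟨ cong (ℚ._* u ^q i) (^q-homo-* u (d ∸ i) i) ⟨
  u ^q (d ∸ i ℕ.+ i) ℚ.* u ^q i         ≡⟨ cong (λ k → u ^q k ℚ.* u ^q i) (ℕ.m∸n+n≡m i≤d) ⟩
  u ^q d ℚ.* u ^q i                     ≡⟨ cong (ℚ._* u ^q i) u^d≡1 ⟩
  1ℚ ℚ.* u ^q i                         ≡⟨ ℚ.*-identityˡ _ ⟩
  u ^q i                                ∎
  where open ≡-Reasoning

-- (2 + k) % 2 reduces to k % 2, which drives the recursions below.
parity : ∀ k → k % 2 ≡ 0 ⊎ Odd k
parity 0             = inj₁ refl
parity 1             = inj₂ refl
parity (suc (suc k)) = parity k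

-1^[2+k]≡-1^k : ∀ k → (- 1ℚ) ^q suc (suc k) ≡ (- 1ℚ) ^q k
-1^[2+k]≡-1^k k = trans (sym (ℚ.*-assoc (- 1ℚ) (- 1ℚ) ((- 1ℚ) ^q k))) (ℚ.*-identityˡ ((- 1ℚ) ^q k))

-1^even≡1 : ∀ k → k % 2 ≡ 0 → (- 1ℚ) ^q k ≡ 1ℚ
-1^even≡1 0             _    = refl
-1^even≡1 (suc (suc k)) even = trans (-1^[2+k]≡-1^k k) (-1^even≡1 k even)

-1^odd≡-1 : ∀ k → Odd k → (- 1ℚ) ^q k ≡ - 1ℚ
-1^odd≡-1 1             _   = refl
-1^odd≡-1 (suc (suc k)) odd = trans (-1^[2+k]≡-1^k k) (-1^odd≡-1 k odd)

IsSign : ℚ → Set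
IsSign u = u ≡ 1ℚ ⊎ u ≡ - 1ℚ

sign-* : ∀ {u v} → IsSign u → IsSign v → IsSign (u ℚ.* v)
sign-* (inj₁ refl) (inj₁ refl) = inj₁ refl
sign-* (inj₁ refl) (inj₂ refl) = inj₂ refl
sign-* (inj₂ refl) (inj₁ refl) = inj₂ refl
sign-* (inj₂ refl) (inj₂ refl) = inj₁ refl

sign-^ : ∀ {u} n → IsSign u → IsSign (u ^q n)
sign-^ zero    _ = inj₁ refl
sign-^ (suc n) s = sign-* s (sign-^ n s)

sign*sign≡1 : ∀ {u} → IsSign u → u ℚ.* u ≡ 1ℚ
sign*sign≡1 (inj₁ refl) = refl
sign*sign≡1 (inj₂ refl) = refl

SameSigns OppositeSigns : ℚ → ℚ → Set
SameSigns     u v = (u ≡ 1ℚ × v ≡ 1ℚ) ⊎ (u ≡ - 1ℚ × v ≡ - 1ℚ)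
OppositeSigns u v = (u ≡ 1ℚ × v ≡ - 1ℚ) ⊎ (u ≡ - 1ℚ × v ≡ 1ℚ)

sign-pair : ∀ {u v} → IsSign u → IsSign v → SameSigns u v ⊎ OppositeSigns u v
sign-pair (inj₁ u≡1)  (inj₁ v≡1)  = inj₁ (inj₁ (u≡1 , v≡1))
sign-pair (inj₂ u≡-1) (inj₂ v≡-1) = inj₁ (inj₂ (u≡-1 , v≡-1))
sign-pair (inj₁ u≡1)  (inj₂ v≡-1) = inj₂ (inj₁ (u≡1 , v≡-1))
sign-pair (inj₂ u≡-1) (inj₁ v≡1)  = inj₂ (inj₂ (u≡-1 , v≡1))

oppositeSigns⇒*≡-1 : ∀ {u v} → OppositeSigns u v → u ℚ.* v ≡ - 1ℚ
oppositeSigns⇒*≡-1 (inj₁ (refl , refl)) = refl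
oppositeSigns⇒*≡-1 (inj₂ (refl , refl)) = refl

0<i⇒¬0<-i : ∀ {i} → ℤ.+ 0 ℤ.< i → ¬ (ℤ.+ 0 ℤ.< ℤ.- i)
0<i⇒¬0<-i 0<i 0<-i = ℤ.<-asym 0<-i (ℤ.neg-mono-< 0<i)

positive-ratio-sign≡1 : ∀ {a b s} → ℤ.+ 0 ℤ.< a → ℤ.+ 0 ℤ.< b → IsSign s →
                        toℚ a ℚ.* s ≡ toℚ b → s ≡ 1ℚ
positive-ratio-sign≡1 _   _   (inj₁ s≡1)  _ = s≡1
positive-ratio-sign≡1 {a} 0<a 0<b (inj₂ refl) a*-1≡b =
  ⊥-elim (0<i⇒¬0<-i 0<a (subst (ℤ.+ 0 ℤ.<_) (toℚ-injective (trans (sym a*-1≡b) (toℚ-*-1 a))) 0<b))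

powerFree-ratio⇒sign : ∀ d {a b u} → DFree d a → DFree d b → u ≢ 0ℚ →
                        toℚ a ℚ.* u ^q d ≡ toℚ b → IsSign u
powerFree-ratio⇒sign d {a} {b} {u@(mkℚ n k n⊥k)} (_ , a-free) (_ , b-free) u≢0 au^d≡b
  = unit-sign n k n⊥k
      (powerFree∧coprime⇒≡1 d b-free n⊥1+k (divides ∣ a ∣ (sym ∣a∣∣n∣^d≡∣b∣[1+k]^d)) ∣n∣≢0)
      (powerFree∧coprime⇒≡1 d a-free (Coprime.sym n⊥1+k) (divides ∣ b ∣ ∣a∣∣n∣^d≡∣b∣[1+k]^d) (λ ()))
  where
  open ≡-Reasoning
  n⊥1+k : Coprime ∣ n ∣ (suc k)
  n⊥1+k = Coprime.recompute n⊥k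

  ∣n∣≢0 : ∣ n ∣ ≢ 0
  ∣n∣≢0 ∣n∣≡0 = u≢0 (ℚ.↥p≡0⇒p≡0 u (ℤ.∣i∣≡0⇒i≡0 ∣n∣≡0))

  an^d≡b[1+k]^d : a ℤ.* n ℤ.^ d ≡ b ℤ.* (+ suc k) ℤ.^ d
  an^d≡b[1+k]^d = toℚ-injective (begin
    toℚ (a ℤ.* n ℤ.^ d)                         ≡⟨ toℚ-* a (n ℤ.^ d) ⟩
    toℚ a ℚ.* toℚ (n ℤ.^ d)                     ≡⟨ cong (toℚ a ℚ.*_) (toℚ-^ n d) ⟩
    toℚ a ℚ.* toℚ n ^q d                        ≡⟨ cong (λ x → toℚ a ℚ.* x ^q d) (*-toℚ-↧≡toℚ-↥ u) ⟨
    toℚ a ℚ.* (u ℚ.* toℚ (+ suc k)) ^q d        ≡⟨ cong (toℚ a ℚ.*_) (^q-distrib-* u _ d) ⟩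
    toℚ a ℚ.* (u ^q d ℚ.* toℚ (+ suc k) ^q d)   ≡⟨ ℚ.*-assoc (toℚ a) _ _ ⟨
    toℚ a ℚ.* u ^q d ℚ.* toℚ (+ suc k) ^q d     ≡⟨ cong₂ ℚ._*_ au^d≡b (sym (toℚ-^ (+ suc k) d)) ⟩
    toℚ b ℚ.* toℚ ((+ suc k) ℤ.^ d)             ≡⟨ toℚ-* b _ ⟨
    toℚ (b ℤ.* (+ suc k) ℤ.^ d)                 ∎)

  ∣a∣∣n∣^d≡∣b∣[1+k]^d : ∣ a ∣ * ∣ n ∣ ^ d ≡ ∣ b ∣ * suc k ^ d
  ∣a∣∣n∣^d≡∣b∣[1+k]^d = begin
    ∣ a ∣ * ∣ n ∣ ^ d               ≡⟨ cong (∣ a ∣ *_) (abs-^ n d) ⟨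
    ∣ a ∣ * ∣ n ℤ.^ d ∣             ≡⟨ ℤ.abs-* a (n ℤ.^ d) ⟨
    ∣ a ℤ.* n ℤ.^ d ∣               ≡⟨ cong ∣_∣ an^d≡b[1+k]^d ⟩
    ∣ b ℤ.* (+ suc k) ℤ.^ d ∣       ≡⟨ ℤ.abs-* b _ ⟩
    ∣ b ∣ * ∣ (+ suc k) ℤ.^ d ∣     ≡⟨ cong (∣ b ∣ *_) (abs-^ (+ suc k) d) ⟩
    ∣ b ∣ * suc k ^ d               ∎

  unit-sign : ∀ n k .(c : Coprime ∣ n ∣ (suc k)) → ∣ n ∣ ≡ 1 → suc k ≡ 1 → IsSign (mkℚ n k c)
  unit-sign (+ 1)     0 _ refl refl = inj₁ refl
  unit-sign -[1+ 0 ] 0 _ refl refl = inj₂ refl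

OddCoefficientsVanish : ∀ {d} → Form d → Set
OddCoefficientsVanish F = ∀ i → Odd (toℕ i) → lookup F i ≡ + 0

FirstOddCoefficientPositive : ∀ d → Form d → Set
FirstOddCoefficientPositive d F =
  ∀ (k : Fin (suc d)) → Odd (toℕ k) → lookup F k ≢ + 0 →
  (∀ (j : Fin (suc d)) → Odd (toℕ j) → toℕ j < toℕ k → lookup F j ≡ + 0) →
  ℤ.+ 0 ℤ.< lookup F k

negatedOddCoefficients⇒oddCoefficientsVanish :
  ∀ {d} {F G : Form d} → FirstOddCoefficientPositive d F → FirstOddCoefficientPositive d G →
  (∀ i → Odd (toℕ i) → lookup G i ≡ ℤ.- lookup F i) → OddCoefficientsVanish F
negatedOddCoefficients⇒oddCoefficientsVanish {F = F} {G} F⁺ G⁺ G≡-F =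
  All.wfRec <-wellFounded 0ℓ _ vanish
  where
  vanish : ∀ k → WfRec Fin._<_ (λ i → Odd (toℕ i) → lookup F i ≡ + 0) k →
           Odd (toℕ k) → lookup F k ≡ + 0
  vanish k below odd-k with lookup F k ℤ.≟ + 0
  ... | yes F_k≡0 = F_k≡0
  ... | no  F_k≢0 = ⊥-elim (0<i⇒¬0<-i (F⁺ k odd-k F_k≢0 F-below)
                      (subst (ℤ.+ 0 ℤ.<_) (G≡-F k odd-k) (G⁺ k odd-k G_k≢0 G-below)))
    where
    F-below : ∀ j → Odd (toℕ j) → toℕ j < toℕ k → lookup F j ≡ + 0
    F-below j odd-j j<k = below j<k odd-j
    G-below : ∀ j → Odd (toℕ j) → toℕ j < toℕ k → lookup G j ≡ + 0
    G-below j odd-j j<k = trans (G≡-F j odd-j) (cong ℤ.-_ (F-below j odd-j j<k))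
    G_k≢0 : lookup G k ≢ + 0
    G_k≢0 G_k≡0 = F_k≢0 (ℤ.neg-injective (trans (sym (G≡-F k odd-k)) G_k≡0))

at-lookup : ∀ {n} (xs : Vec ℤ n) i → at xs (toℕ i) ≡ lookup xs i
at-lookup (x ∷ xs) Fin.zero    = refl
at-lookup (x ∷ xs) (Fin.suc i) = at-lookup xs i

at-tabulate : ∀ {n} (f : ℕ → ℤ) {m} → m < n → at (tabulate {n = n} (λ j → f (toℕ j))) m ≡ f m
at-tabulate {suc n} f {zero}  _         = refl
at-tabulate {suc n} f {suc m} (s≤s m<n) = at-tabulate (λ k → f (suc k)) m<n

sqArgCoeff-even : ∀ {e} (H : Form e) i → i % 2 ≡ 0 → sqArgCoeff H i ≡ at H (i / 2)
sqArgCoeff-even H i even rewrite dec-true (i % 2 ℕ.≟ 0) even = refl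

sqArgCoeff-odd : ∀ {e} (H : Form e) i → Odd i → sqArgCoeff H i ≡ + 0
sqArgCoeff-odd H i odd rewrite dec-false (i % 2 ℕ.≟ 0) (λ even → ℕ.1+n≢0 (trans (sym odd) even)) = refl

oddCoefficientsVanish⇒squaredArgs : ∀ {d} (F : Form d) → lookup F (fromℕ d) ≢ + 0 →
                                    OddCoefficientsVanish F → SquaredArgs F
oddCoefficientsVanish⇒squaredArgs {d} F F_d≢0 odd≡0 = d / 2 , H , sym (twice-half d-even) , coefficient
  where
  open ≡-Reasoning
  twice-half : ∀ {k} → k % 2 ≡ 0 → 2 * (k / 2) ≡ k
  twice-half {k} even = m*[n/m]≡n (m%n≡0⇒n∣m k 2 even)

  d-even : d % 2 ≡ 0
  d-even with parity d
  ... | inj₁ even = even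
  ... | inj₂ odd  = ⊥-elim (F_d≢0 (odd≡0 (fromℕ d) (subst Odd (sym (Fin.toℕ-fromℕ d)) odd)))

  H : Form (d / 2)
  H = tabulate (λ j → at F (2 * toℕ j))

  coefficient : ∀ i → lookup F i ≡ sqArgCoeff H (toℕ i)
  coefficient i with parity (toℕ i)
  ... | inj₂ odd  = trans (odd≡0 i odd) (sym (sqArgCoeff-odd H (toℕ i) odd))
  ... | inj₁ even = begin
    lookup F i                    ≡⟨ at-lookup F i ⟨
    at F (toℕ i)                  ≡⟨ cong (at F) (twice-half even) ⟨
    at F (2 * (toℕ i / 2))        ≡⟨ at-tabulate (λ k → at F (2 * k)) (s≤s (/-monoˡ-≤ 2 (Fin.toℕ≤pred[n] i))) ⟨
    at H (toℕ i / 2)              ≡⟨ sqArgCoeff-even H (toℕ i) even ⟨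
    sqArgCoeff H (toℕ i)          ∎

module DiagonalDilation {d} (F G : Form d) (cF : Conditions d F) (cG : Conditions d G)
                        {u v : ℚ} (u≢0 : u ≢ 0ℚ) (v≢0 : v ≢ 0ℚ) (F∘γ≡G : DilatesTo F u v G) where

  open ≡-Reasoning

  leading : toℚ (lookup F Fin.zero) ℚ.* u ^q d ≡ toℚ (lookup G Fin.zero)
  leading = trans (cong (toℚ (lookup F Fin.zero) ℚ.*_) (sym (ℚ.*-identityʳ (u ^q d)))) (F∘γ≡G Fin.zero)

  trailing : toℚ (lookup F (fromℕ d)) ℚ.* v ^q d ≡ toℚ (lookup G (fromℕ d))
  trailing = begin
    F_d ℚ.* v ^q d                     ≡⟨ cong (F_d ℚ.*_) (ℚ.*-identityˡ (v ^q d)) ⟨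
    F_d ℚ.* (u ^q 0 ℚ.* v ^q d)        ≡⟨ cong (λ k → F_d ℚ.* (u ^q k ℚ.* v ^q d)) (ℕ.n∸n≡0 d) ⟨
    F_d ℚ.* (u ^q (d ∸ d) ℚ.* v ^q d)  ≡⟨ cong (λ k → F_d ℚ.* (u ^q (d ∸ k) ℚ.* v ^q k)) (Fin.toℕ-fromℕ d) ⟨
    dilate F u v (fromℕ d)             ≡⟨ F∘γ≡G (fromℕ d) ⟩
    toℚ (lookup G (fromℕ d))           ∎
    where
    F_d : ℚ
    F_d = toℚ (lookup F (fromℕ d))

  u-sign : IsSign u
  u-sign = let (_ , _ , F₀-free , _) = cF ; (_ , _ , G₀-free , _) = cG
           in powerFree-ratio⇒sign d F₀-free G₀-free u≢0 leading

  v-sign : IsSign v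
  v-sign = let (_ , _ , _ , F_d-free , _) = cF ; (_ , _ , _ , G_d-free , _) = cG
           in powerFree-ratio⇒sign d F_d-free G_d-free v≢0 trailing

  u^d≡1 : u ^q d ≡ 1ℚ
  u^d≡1 = let (0<F₀ , _) = cF ; (0<G₀ , _) = cG
          in positive-ratio-sign≡1 0<F₀ 0<G₀ (sign-^ d u-sign) leading

  coefficient : ∀ i → toℚ (lookup F i) ℚ.* (u ℚ.* v) ^q toℕ i ≡ toℚ (lookup G i)
  coefficient i = begin
    F_i ℚ.* (u ℚ.* v) ^q toℕ i                 ≡⟨ cong (F_i ℚ.*_) (^q-distrib-* u v (toℕ i)) ⟩
    F_i ℚ.* (u ^q toℕ i ℚ.* v ^q toℕ i)        ≡⟨ cong (λ x → F_i ℚ.* (x ℚ.* v ^q toℕ i)) u^[d∸i]≡u^i′ ⟨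
    F_i ℚ.* (u ^q (d ∸ toℕ i) ℚ.* v ^q toℕ i)  ≡⟨ F∘γ≡G i ⟩
    toℚ (lookup G i)                           ∎
    where
    F_i : ℚ
    F_i = toℚ (lookup F i)
    u^[d∸i]≡u^i′ : u ^q (d ∸ toℕ i) ≡ u ^q toℕ i
    u^[d∸i]≡u^i′ = u^[d∸i]≡u^i d (sign*sign≡1 u-sign) u^d≡1 (Fin.toℕ≤pred[n] i)

  oddCoefficients-negated : u ℚ.* v ≡ - 1ℚ → ∀ i → Odd (toℕ i) → lookup G i ≡ ℤ.- lookup F i
  oddCoefficients-negated uv≡-1 i odd = toℚ-injective (begin
    toℚ (lookup G i)                             ≡⟨ coefficient i ⟨
    toℚ (lookup F i) ℚ.* (u ℚ.* v) ^q toℕ i      ≡⟨ cong (λ w → toℚ (lookup F i) ℚ.* w ^q toℕ i) uv≡-1 ⟩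
    toℚ (lookup F i) ℚ.* (- 1ℚ) ^q toℕ i         ≡⟨ cong (toℚ (lookup F i) ℚ.*_) (-1^odd≡-1 (toℕ i) odd) ⟩
    toℚ (lookup F i) ℚ.* - 1ℚ                    ≡⟨ toℚ-*-1 (lookup F i) ⟩
    toℚ (ℤ.- lookup F i)                         ∎)

  oddCoefficientsVanish : u ℚ.* v ≡ - 1ℚ → OddCoefficientsVanish F
  oddCoefficientsVanish uv≡-1 =
    let (_ , _ , _ , _ , F⁺) = cF ; (_ , _ , _ , _ , G⁺) = cG
    in negatedOddCoefficients⇒oddCoefficientsVanish {F = F} {G} F⁺ G⁺ (oddCoefficients-negated uv≡-1)

  F≡G : F ≡ G
  F≡G = Pointwise-≡⇒≡ (ext F_i≡G_i)
    where
    unchanged : ∀ i → (u ℚ.* v) ^q toℕ i ≡ 1ℚ → lookup F i ≡ lookup G i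
    unchanged i factor≡1 = toℚ-injective
      (trans (sym (ℚ.*-identityʳ _)) (trans (cong (toℚ (lookup F i) ℚ.*_) (sym factor≡1)) (coefficient i)))

    F_i≡G_i : ∀ i → lookup F i ≡ lookup G i
    F_i≡G_i i with sign-* u-sign v-sign | parity (toℕ i)
    ... | inj₁ uv≡1  | _         = unchanged i (trans (cong (_^q toℕ i) uv≡1) (1^q≡1 (toℕ i)))
    ... | inj₂ uv≡-1 | inj₁ even = unchanged i (trans (cong (_^q toℕ i) uv≡-1) (-1^even≡1 (toℕ i) even))
    ... | inj₂ uv≡-1 | inj₂ odd  = trans F_i≡0 (sym (trans (oddCoefficients-negated uv≡-1 i odd) (cong ℤ.-_ F_i≡0)))
      where
      F_i≡0 : lookup F i ≡ + 0
      F_i≡0 = oddCoefficientsVanish uv≡-1 i odd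

  squaredArgs : u ℚ.* v ≡ - 1ℚ → SquaredArgs F
  squaredArgs uv≡-1 = let (_ , F_d≢0 , _) = cF
                      in oddCoefficientsVanish⇒squaredArgs F F_d≢0 (oddCoefficientsVanish uv≡-1)

lemma5p2 : (d : ℕ) → 3 ≤ d → (W : Form d → Set) →
    (∀ F → W F → InBin F × Conditions d F) →
    DilationFree W ×
    (∀ F → W F → (u v : ℚ) → u ≢ 0ℚ → v ≢ 0ℚ → DilatesTo F u v F →
      (¬ SquaredArgs F → (u ≡ 1ℚ × v ≡ 1ℚ) ⊎ (u ≡ - 1ℚ × v ≡ - 1ℚ)) ×
      (SquaredArgs F →
        ((u ≡ 1ℚ × v ≡ 1ℚ) ⊎ (u ≡ - 1ℚ × v ≡ - 1ℚ)) ⊎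
        ((u ≡ 1ℚ × v ≡ - 1ℚ) ⊎ (u ≡ - 1ℚ × v ≡ 1ℚ))))
-- Neither InBin F nor 3 ≤ d is used: the coefficient conditions alone suffice.
lemma5p2 d _ W W⇒bin×conditions = dilationFree , selfDilation
  where
  conditions : ∀ {F} → W F → Conditions d F
  conditions {F} wF = proj₂ (W⇒bin×conditions F wF)

  dilationFree : DilationFree W
  dilationFree F G wF wG u v u≢0 v≢0 = DiagonalDilation.F≡G F G (conditions wF) (conditions wG) u≢0 v≢0

  selfDilation : ∀ F → W F → (u v : ℚ) → u ≢ 0ℚ → v ≢ 0ℚ → DilatesTo F u v F →
                 (¬ SquaredArgs F → SameSigns u v) × (SquaredArgs F → SameSigns u v ⊎ OppositeSigns u v)
  selfDilation F wF u v u≢0 v≢0 F∘γ≡F = notSquared , λ _ → signs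
    where
    open DiagonalDilation F F (conditions wF) (conditions wF) u≢0 v≢0 F∘γ≡F
    signs : SameSigns u v ⊎ OppositeSigns u v
    signs = sign-pair u-sign v-sign

    notSquared : ¬ SquaredArgs F → SameSigns u v
    notSquared ¬squared with signs
    ... | inj₁ same     = same
    ... | inj₂ opposite = ⊥-elim (¬squared (squaredArgs (oppositeSigns⇒*≡-1 opposite)))
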